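{- Let $c_1,c_2$ be positive integers and $n$ a nonzero integer. Let $x,y\in\mathbb{Z}$ with $(x,c_1)=1$, $(y,c_2)=1$ and $c_2x+c_1y=n$. Let $\bar x\in\mathbb{Z}$ be an inverse of $x$ modulo $c_1$ and $\bar y\in\mathbb{Z}$ an inverse of $y$ modulo $c_2$. Then there exists a pair of integers $(r_1,r_2)$ with $r_1r_2\equiv1\pmod n$ and $$\bar x=\frac{c_2+c_1r_1}{n},\qquad \bar y=\frac{c_1+c_2r_2}{n}.$$ The pair $(r_1,r_2)$ is uniquely determined modulo $n$ by the equivalence class of $(x,y)$ in $\overline{X}(c_1,c_2,n)$, and the resulting map from $X(c_1,c_2,n)$ to the set of pairs $(r_1,r_2)$ modulo $n$ is injective.
   Context: $\overline{X}(c_1,c_2,n)$ is the set of equivalence classes of pairs $(x,y)\in\mathbb{Z}^2$ with $(x,c_1)=1$, $(y,c_2)=1$, $c_2x+c_1y=n$, where $(x,y)\sim(x',y')$ iff $x\equiv x'\pmod{c_1}$ and $y\equiv y'\pmod{c_2}$. $X(c_1,c_2,n)$ is a set of representatives of these classes. -}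

module Defs where

open import Data.Integer using (ℤ; +_; _+_; _-_; _*_)
open import Data.Integer.Divisibility using (_∣_)
open import Data.Integer.Coprimality using (Coprime)
open import Data.Product using (_×_)
open import Relation.Binary.PropositionalEquality using (_≡_)

infix 4 _≡_[mod_]

_≡_[mod_] : ℤ → ℤ → ℤ → Set
a ≡ b [mod m ] = m ∣ (a - b)

InX : ℤ → ℤ → ℤ → ℤ → ℤ → Set
InX c₁ c₂ n x y = Coprime x c₁ × Coprime y c₂ × (c₂ * x + c₁ * y ≡ n)

SameClass : ℤ → ℤ → ℤ → ℤ → ℤ → ℤ → Set
SameClass c₁ c₂ x y x' y' = (x ≡ x' [mod c₁ ]) × (y ≡ y' [mod c₂ ])

IsInverseMod : ℤ → ℤ → ℤ → Set
IsInverseMod x x̄ m = x * x̄ ≡ + 1 [mod m ]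

-- x̄ = (c₂ + c₁ r₁)/n  and  ȳ = (c₁ + c₂ r₂)/n  (exact division, n ≠ 0),
-- written multiplicatively
RFormula : ℤ → ℤ → ℤ → ℤ → ℤ → ℤ → ℤ → Set
RFormula c₁ c₂ n x̄ ȳ r₁ r₂ = (n * x̄ ≡ c₂ + c₁ * r₁) × (n * ȳ ≡ c₁ + c₂ * r₂)

{-# OPTIONS --safe #-}
-- Write x x̄ = 1 + k₁ c₁ and y ȳ = 1 + k₂ c₂. Multiplying c₂ x + c₁ y = n by x̄ gives
-- n x̄ = c₂ + c₁ (c₂ k₁ + y x̄), and symmetrically n ȳ = c₁ + c₂ (c₁ k₂ + x ȳ); the product of
-- r₁ = c₂ k₁ + y x̄ and r₂ = c₁ k₂ + x ȳ is 1 + (k₁ ȳ + k₂ x̄) n. For two such pairs,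
-- n (x̄ - x̄') = c₁ (r₁ - r₁'), so as c₁ and n are nonzero, x̄ ≡ x̄' (mod c₁) iff r₁ ≡ r₁' (mod n);
-- and x̄ ≡ x̄' (mod c₁) iff x ≡ x' (mod c₁), inverses of congruent units being congruent.
module Submission where

open import Defs
open import Data.Integer using (ℤ; +_; _+_; _-_; _*_; _<_)
open import Data.Integer.Base using (NonZero; ≢-nonZero; >-nonZero)
open import Data.Integer.Properties using (*-comm)
open import Data.Integer.Divisibility.Signed
  using (_∣_; divides; ∣ᵤ⇒∣; ∣⇒∣ᵤ; ∣m∣n⇒∣m-n; ∣n⇒∣m*n; *-monoʳ-∣; *-cancelˡ-∣)
open import Data.Integer.Tactic.RingSolver using (solve)
open import Data.List using ([]; _∷_)
open import Data.Product using (_×_; _,_; ∃₂)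
open import Function using (_$_)
open import Relation.Binary.PropositionalEquality
  using (_≡_; _≢_; refl; sym; cong; cong₂; subst; subst₂; module ≡-Reasoning)

m-1≡k⇒m-k≡1 : ∀ m {k : ℤ} → m - + 1 ≡ k → m - k ≡ + 1
m-1≡k⇒m-k≡1 m refl = solve (m ∷ [])

∣-transfer : ∀ {a b u v : ℤ} .{{_ : NonZero b}} → a * u ≡ b * v → b ∣ u → a ∣ v
∣-transfer {a} {b} au≡bv b∣u =
  *-cancelˡ-∣ b (subst₂ _∣_ (*-comm a b) au≡bv (*-monoʳ-∣ a b∣u))

inverse-sym : ∀ {c} x x̄ → c ∣ x * x̄ - + 1 → c ∣ x̄ * x - + 1
inverse-sym {c} x x̄ = subst (λ t → c ∣ t - + 1) (*-comm x x̄)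

inverse-cong : ∀ {c} x x' x̄ x̄' →
  c ∣ x - x' → c ∣ x * x̄ - + 1 → c ∣ x' * x̄' - + 1 → c ∣ x̄ - x̄'
inverse-cong {c} x x' x̄ x̄' x≡x' x̄-inv x̄'-inv =
  subst (c ∣_) identity
    (∣m∣n⇒∣m-n (∣m∣n⇒∣m-n (∣n⇒∣m*n x̄' x̄-inv) (∣n⇒∣m*n x̄ x̄'-inv)) (∣n⇒∣m*n (x̄ * x̄') x≡x'))
  where
  identity : x̄' * (x * x̄ - + 1) - x̄ * (x' * x̄' - + 1) - x̄ * x̄' * (x - x') ≡ x̄ - x̄'
  identity = solve (x ∷ x' ∷ x̄ ∷ x̄' ∷ [])

r-exists : ∀ c₁ c₂ n x y x̄ ȳ → c₂ * x + c₁ * y ≡ n →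
  IsInverseMod x x̄ c₁ → IsInverseMod y ȳ c₂ →
  ∃₂ λ r₁ r₂ → (r₁ * r₂ ≡ + 1 [mod n ]) × RFormula c₁ c₂ n x̄ ȳ r₁ r₂
r-exists c₁ c₂ _ x y x̄ ȳ refl x̄-inv ȳ-inv
  with ∣ᵤ⇒∣ {c₁} {x * x̄ - + 1} x̄-inv | ∣ᵤ⇒∣ {c₂} {y * ȳ - + 1} ȳ-inv
... | divides k₁ x̄-inv′ | divides k₂ ȳ-inv′ =
  c₂ * k₁ + y * x̄ , c₁ * k₂ + x * ȳ , ∣⇒∣ᵤ n∣r₁r₂-1 , n*x̄≡ , n*ȳ≡
  where
  open ≡-Reasoning

  x̄-unit : x * x̄ - k₁ * c₁ ≡ + 1
  x̄-unit = m-1≡k⇒m-k≡1 (x * x̄) x̄-inv′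

  ȳ-unit : y * ȳ - k₂ * c₂ ≡ + 1
  ȳ-unit = m-1≡k⇒m-k≡1 (y * ȳ) ȳ-inv′

  n*x̄≡ : (c₂ * x + c₁ * y) * x̄ ≡ c₂ + c₁ * (c₂ * k₁ + y * x̄)
  n*x̄≡ = begin
    (c₂ * x + c₁ * y) * x̄                            ≡⟨ solve (c₁ ∷ c₂ ∷ x ∷ y ∷ x̄ ∷ k₁ ∷ []) ⟩
    c₂ * (x * x̄ - k₁ * c₁) + c₁ * (c₂ * k₁ + y * x̄) ≡⟨ cong (λ s → c₂ * s + c₁ * (c₂ * k₁ + y * x̄)) x̄-unit ⟩
    c₂ * + 1 + c₁ * (c₂ * k₁ + y * x̄)               ≡⟨ solve (c₁ ∷ c₂ ∷ y ∷ x̄ ∷ k₁ ∷ []) ⟩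
    c₂ + c₁ * (c₂ * k₁ + y * x̄)                      ∎

  n*ȳ≡ : (c₂ * x + c₁ * y) * ȳ ≡ c₁ + c₂ * (c₁ * k₂ + x * ȳ)
  n*ȳ≡ = begin
    (c₂ * x + c₁ * y) * ȳ                            ≡⟨ solve (c₁ ∷ c₂ ∷ x ∷ y ∷ ȳ ∷ k₂ ∷ []) ⟩
    c₁ * (y * ȳ - k₂ * c₂) + c₂ * (c₁ * k₂ + x * ȳ) ≡⟨ cong (λ s → c₁ * s + c₂ * (c₁ * k₂ + x * ȳ)) ȳ-unit ⟩
    c₁ * + 1 + c₂ * (c₁ * k₂ + x * ȳ)               ≡⟨ solve (c₁ ∷ c₂ ∷ x ∷ ȳ ∷ k₂ ∷ []) ⟩
    c₁ + c₂ * (c₁ * k₂ + x * ȳ)                      ∎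

  n∣r₁r₂-1 : c₂ * x + c₁ * y ∣ (c₂ * k₁ + y * x̄) * (c₁ * k₂ + x * ȳ) - + 1
  n∣r₁r₂-1 = divides (k₁ * ȳ + k₂ * x̄) $ begin
    (c₂ * k₁ + y * x̄) * (c₁ * k₂ + x * ȳ) - + 1
      ≡⟨ solve (c₁ ∷ c₂ ∷ x ∷ y ∷ x̄ ∷ ȳ ∷ k₁ ∷ k₂ ∷ []) ⟩
    (k₁ * ȳ + k₂ * x̄) * (c₂ * x + c₁ * y) + ((x * x̄ - k₁ * c₁) * (y * ȳ - k₂ * c₂) - + 1)
      ≡⟨ cong₂ (λ s t → (k₁ * ȳ + k₂ * x̄) * (c₂ * x + c₁ * y) + (s * t - + 1)) x̄-unit ȳ-unit ⟩
    (k₁ * ȳ + k₂ * x̄) * (c₂ * x + c₁ * y) + (+ 1 * + 1 - + 1)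
      ≡⟨ solve (c₁ ∷ c₂ ∷ x ∷ y ∷ x̄ ∷ ȳ ∷ k₁ ∷ k₂ ∷ []) ⟩
    (k₁ * ȳ + k₂ * x̄) * (c₂ * x + c₁ * y) ∎

module _ (c n a x x' x̄ x̄' r r' : ℤ)
         (x̄-inv : IsInverseMod x x̄ c) (x̄'-inv : IsInverseMod x' x̄' c)
         (e : n * x̄ ≡ a + c * r) (e' : n * x̄' ≡ a + c * r') where

  private
    scaled-difference : n * (x̄ - x̄') ≡ c * (r - r')
    scaled-difference = begin
      n * (x̄ - x̄')              ≡⟨ solve (n ∷ x̄ ∷ x̄' ∷ []) ⟩
      n * x̄ - n * x̄'            ≡⟨ cong₂ _-_ e e' ⟩
      (a + c * r) - (a + c * r') ≡⟨ solve (a ∷ c ∷ r ∷ r' ∷ []) ⟩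
      c * (r - r')               ∎
      where open ≡-Reasoning

    c∣xx̄-1 : c ∣ x * x̄ - + 1
    c∣xx̄-1 = ∣ᵤ⇒∣ x̄-inv

    c∣x'x̄'-1 : c ∣ x' * x̄' - + 1
    c∣x'x̄'-1 = ∣ᵤ⇒∣ x̄'-inv

  r-well-defined : .{{_ : NonZero c}} → x ≡ x' [mod c ] → r ≡ r' [mod n ]
  r-well-defined x≡x' = ∣⇒∣ᵤ n∣r-r'
    where
    c∣x̄-x̄' : c ∣ x̄ - x̄'
    c∣x̄-x̄' = inverse-cong x x' x̄ x̄' (∣ᵤ⇒∣ x≡x') c∣xx̄-1 c∣x'x̄'-1
    n∣r-r' : n ∣ r - r'
    n∣r-r' = ∣-transfer scaled-difference c∣x̄-x̄'

  r-injective : .{{_ : NonZero n}} → r ≡ r' [mod n ] → x ≡ x' [mod c ]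
  r-injective r≡r' = ∣⇒∣ᵤ c∣x-x'
    where
    n∣r-r' : n ∣ r - r'
    n∣r-r' = ∣ᵤ⇒∣ r≡r'
    c∣x̄-x̄' : c ∣ x̄ - x̄'
    c∣x̄-x̄' = ∣-transfer (sym scaled-difference) n∣r-r'
    c∣x-x' : c ∣ x - x'
    c∣x-x' = inverse-cong x̄ x̄' x x' c∣x̄-x̄' (inverse-sym x x̄ c∣xx̄-1) (inverse-sym x' x̄' c∣x'x̄'-1)

proposition6p3 : (c₁ c₂ n : ℤ) → + 0 < c₁ → + 0 < c₂ → n ≢ + 0 →
    -- existence of (r₁ , r₂)
    ((x y x̄ ȳ : ℤ) → InX c₁ c₂ n x y →
       IsInverseMod x x̄ c₁ → IsInverseMod y ȳ c₂ →
       ∃₂ λ r₁ r₂ → (r₁ * r₂ ≡ + 1 [mod n ]) × RFormula c₁ c₂ n x̄ ȳ r₁ r₂)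
    ×
    -- (r₁ , r₂) mod n depends only on the class of (x , y) (and not on the choice of inverses)
    ((x y x' y' x̄ ȳ x̄' ȳ' r₁ r₂ r₁' r₂' : ℤ) →
       InX c₁ c₂ n x y → InX c₁ c₂ n x' y' → SameClass c₁ c₂ x y x' y' →
       IsInverseMod x x̄ c₁ → IsInverseMod y ȳ c₂ →
       IsInverseMod x' x̄' c₁ → IsInverseMod y' ȳ' c₂ →
       RFormula c₁ c₂ n x̄ ȳ r₁ r₂ → RFormula c₁ c₂ n x̄' ȳ' r₁' r₂' →
       (r₁ ≡ r₁' [mod n ]) × (r₂ ≡ r₂' [mod n ]))
    ×
    -- injectivity: equal pairs mod n force the same class
    ((x y x' y' x̄ ȳ x̄' ȳ' r₁ r₂ r₁' r₂' : ℤ) →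
       InX c₁ c₂ n x y → InX c₁ c₂ n x' y' →
       IsInverseMod x x̄ c₁ → IsInverseMod y ȳ c₂ →
       IsInverseMod x' x̄' c₁ → IsInverseMod y' ȳ' c₂ →
       RFormula c₁ c₂ n x̄ ȳ r₁ r₂ → RFormula c₁ c₂ n x̄' ȳ' r₁' r₂' →
       (r₁ ≡ r₁' [mod n ]) → (r₂ ≡ r₂' [mod n ]) →
       SameClass c₁ c₂ x y x' y')
proposition6p3 c₁ c₂ n 0<c₁ 0<c₂ n≢0 =
  (λ x y x̄ ȳ (_ , _ , n≡) → r-exists c₁ c₂ n x y x̄ ȳ n≡) ,
  (λ x y x' y' x̄ ȳ x̄' ȳ' r₁ r₂ r₁' r₂' _ _ (x≡x' , y≡y') x̄-inv ȳ-inv x̄'-inv ȳ'-inv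
     (e₁ , e₂) (e₁' , e₂') →
     r-well-defined c₁ n c₂ x x' x̄ x̄' r₁ r₁' x̄-inv x̄'-inv e₁ e₁' x≡x' ,
     r-well-defined c₂ n c₁ y y' ȳ ȳ' r₂ r₂' ȳ-inv ȳ'-inv e₂ e₂' y≡y') ,
  (λ x y x' y' x̄ ȳ x̄' ȳ' r₁ r₂ r₁' r₂' _ _ x̄-inv ȳ-inv x̄'-inv ȳ'-inv
     (e₁ , e₂) (e₁' , e₂') r₁≡r₁' r₂≡r₂' →
     r-injective c₁ n c₂ x x' x̄ x̄' r₁ r₁' x̄-inv x̄'-inv e₁ e₁' r₁≡r₁' ,
     r-injective c₂ n c₁ y y' ȳ ȳ' r₂ r₂' ȳ-inv ȳ'-inv e₂ e₂' r₂≡r₂')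
  where
  instance
    c₁≢0 : NonZero c₁
    c₁≢0 = >-nonZero 0<c₁
    c₂≢0 : NonZero c₂
    c₂≢0 = >-nonZero 0<c₂
    n≢0′ : NonZero n
    n≢0′ = ≢-nonZero n≢0
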